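{- Let $n\ge1$. For each $\delta\in\mathrm{MAD}(c^\times)$, we have $\Psi(\delta)\in\overline{\mathcal M}_{n+1}$ and $|\delta|=n-\#_{\mathtt U}(\Psi(\delta))$, where $\#_{\mathtt U}(P)$ denotes the number of letters $\mathtt U$ in a word $P$.
   Context: Place points labeled $1,\dots,n+1$ from left to right on a horizontal line. An arc is a curve moving monotonically rightward from a point $i$ to a point $j>i$, passing above or below each of $i+1,\dots,j-1$; arcs are identified if they have the same endpoints and pass above the same points. A noncrossing arc diagram is a set of arcs that can be drawn so that no two share a left endpoint, no two share a right endpoint, and no two cross in their interiors; $|\delta|$ is the number of arcs. An arc is $c^\times$-sortable if it passes above every odd interior point and below every even interior point. $\mathrm{MAD}(c^\times)$ is the set of noncrossing arc diagrams all of whose arcs are $c^\times$-sortable and that are maximal under inclusion among such diagrams. A Motzkin path of length $m$ is a word over $\{\mathtt U,\mathtt D,\mathtt H\}$ of length $m$ with equally many $\mathtt U$'s and $\mathtt D$'s and at least as many $\mathtt U$'s as $\mathtt D$'s in every prefix; a peak is a consecutive $\mathtt U\mathtt D$, of height $\#\mathtt U-\#\mathtt D$ in the prefix ending with that $\mathtt U$; $\overline{\mathcal M}_m$ is the set of Motzkin paths of length $m$ with no peak of height $1$. For $\delta\in\mathrm{MAD}(c^\times)$, $\Psi(\delta)=\mathtt M_1\cdots\mathtt M_{n+1}$ with $\mathtt M_i=\mathtt U$ if $i\le n$ and $i+1$ is not the right endpoint of an arc of $\delta$; $\mathtt M_i=\mathtt D$ if $i\ge2$ and $i-1$ is not the left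 endpoint of an arc of $\delta$; $\mathtt M_i=\mathtt H$ otherwise. (For such $\delta$ the first two cases never hold simultaneously, so $\Psi(\delta)$ is a well-defined word.) -}

module Defs where

open import Data.Bool.Base using (Bool; true; false; if_then_else_; not; _∧_)
open import Data.Nat.Base using (ℕ; zero; suc; _+_; _≤_; _<_; _≡ᵇ_; _≤ᵇ_)
open import Data.Product.Base using (_×_; _,_; proj₁; proj₂; ∃; ∃-syntax)
open import Data.Sum.Base using (_⊎_)
open import Data.List.Base using (List; []; _∷_; _++_; _∷ʳ_; map; length; upTo)
open import Data.Bool.ListAction using (any)
open import Data.List.Membership.Propositional using (_∈_)
open import Data.List.Relation.Unary.Unique.Propositional using (Unique)
open import Relation.Binary.PropositionalEquality using (_≡_; _≢_)
open import Relation.Nullary using (¬_)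

-- Arcs on the points 1, ..., n+1.
-- A general arc is given by its endpoints (i , j) with i < j together
-- with a predicate  above : ℕ → Bool  saying over which interior points
-- it passes (only its values on i+1,...,j-1 matter).

Endpoints : Set
Endpoints = ℕ × ℕ

Interior : Endpoints → ℕ → Set
Interior (i , j) x = i < x × x < j

IsEndpoint : Endpoints → ℕ → Set
IsEndpoint (i , j) x = (x ≡ i) ⊎ (x ≡ j)

ForcedAbove : (α : Endpoints) (aboveα : ℕ → Bool)
              (β : Endpoints) (aboveβ : ℕ → Bool) → ℕ → Set
ForcedAbove α aα β aβ x =
    (Interior α x × IsEndpoint β x × aα x ≡ true)
  ⊎ (IsEndpoint α x × Interior β x × aβ x ≡ false)

-- Two arcs (monotone curves) must cross in their interiors iff at some
-- position α is forced above β and at another position β is forced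
-- above α.
Cross : (α : Endpoints) (aα : ℕ → Bool) (β : Endpoints) (aβ : ℕ → Bool) → Set
Cross α aα β aβ = ∃[ x ] ∃[ y ] (ForcedAbove α aα β aβ x × ForcedAbove β aβ α aα y)

-- c^×-sortable arcs: pass above odd interior points, below even ones.
-- Such an arc is determined by its endpoints.

isOdd : ℕ → Bool
isOdd zero = false
isOdd (suc k) = not (isOdd k)

sortableAbove : ℕ → Bool
sortableAbove = isOdd

IsArc : ℕ → Endpoints → Set
IsArc n (i , j) = 1 ≤ i × i < j × j ≤ suc n

-- a noncrossing arc diagram on 1..n+1 all of whose arcs are c^×-sortable;
-- a diagram is a finite set of arcs, represented by a duplicate-free list
IsSortableNCD : ℕ → List Endpoints → Set
IsSortableNCD n δ =
    Unique δ
  × (∀ a → a ∈ δ → IsArc n a)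
  × (∀ a b → a ∈ δ → b ∈ δ → a ≢ b →
        (proj₁ a ≢ proj₁ b) × (proj₂ a ≢ proj₂ b)
      × ¬ Cross a sortableAbove b sortableAbove)

IsMAD : ℕ → List Endpoints → Set
IsMAD n δ =
    IsSortableNCD n δ
  × (∀ δ' → IsSortableNCD n δ' → (∀ a → a ∈ δ → a ∈ δ') → ∀ a → a ∈ δ' → a ∈ δ)

data Step : Set where
  U D H : Step

countU : List Step → ℕ
countU [] = 0
countU (U ∷ w) = suc (countU w)
countU (_ ∷ w) = countU w

countD : List Step → ℕ
countD [] = 0
countD (D ∷ w) = suc (countD w)
countD (_ ∷ w) = countD w

IsMotzkin : ℕ → List Step → Set
IsMotzkin m w =
    length w ≡ m
  × countU w ≡ countD w
  × (∀ xs ys → w ≡ xs ++ ys → countD xs ≤ countU xs)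

HasPeakOfHeight1 : List Step → Set
HasPeakOfHeight1 w =
  ∃[ xs ] ∃[ ys ] (w ≡ xs ++ (U ∷ D ∷ ys) × countU (xs ∷ʳ U) ≡ 1 + countD (xs ∷ʳ U))

IsMotzkinBar : ℕ → List Step → Set
IsMotzkinBar m w = IsMotzkin m w × ¬ HasPeakOfHeight1 w

isRightEnd : List Endpoints → ℕ → Bool
isRightEnd δ x = any (λ a → proj₂ a ≡ᵇ x) δ

isLeftEnd : List Endpoints → ℕ → Bool
isLeftEnd δ x = any (λ a → proj₁ a ≡ᵇ x) δ

letter : ℕ → List Endpoints → ℕ → Step
letter n δ i =
  if (i ≤ᵇ n) ∧ not (isRightEnd δ (suc i)) then U
  else if (2 ≤ᵇ i) ∧ not (isLeftEnd δ (i Data.Nat.Base.∸ 1)) then D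
  else H

Ψ : ℕ → List Endpoints → List Step
Ψ n δ = map (λ k → letter n δ (suc k)) (upTo (suc n))

module Submission where

-- Letter i of Ψ(δ) is U exactly when i+1 is not a right end, and D exactly when i-1 is not a left
-- end: otherwise the short arc (i-1 , i+1), which never crosses a c^×-sortable arc, could be added
-- to δ. Hence among the first m letters the U's and the right ends up to m+1 add up to m, and the
-- D's and the left ends up to m-1 add up to m-1; this gives |δ| + #U = n = |δ| + #D, and since an
-- arc ending by k+2 starts by k+1 it also gives #D ≤ #U on prefixes. At a peak of height 1 after
-- position p+1 the arcs ending by p+2 are exactly those starting by p, so no arc passes over p+1 or
-- p+2 and the unit arc (p+1 , p+2) could be added to δ.

open import Defs
open import Data.Nat.Base using (ℕ; zero; suc; _+_; _≤_; _<_; z≤n; s≤s; _≤ᵇ_; _<ᵇ_; _≡ᵇ_)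
open import Data.Nat.Properties
  using (≤-refl; ≤-trans; ≤-antisym; ≤-pred; ≤-reflexive; <⇒≤; <-irrefl; ≤∧≢⇒<; m≤n⇒m<n∨m≡n;
         n≤1+n; +-comm; +-suc; +-identityʳ; _≤?_; +-cancelˡ-≡; +-cancelʳ-≡; +-cancelʳ-≤; +-monoʳ-≤; +-mono-≤;
         +-mono-<-≤; +-mono-≤-<; ≤⇒≤ᵇ; ≤ᵇ⇒≤; ≡⇒≡ᵇ; ≡ᵇ⇒≡; _≟_; +-commutativeSemigroup; module ≤-Reasoning)
open import Algebra.Properties.CommutativeSemigroup +-commutativeSemigroup using (interchange)
open import Data.Bool.Base using (Bool; true; false; not; _∧_; if_then_else_; T)
open import Data.Bool.Properties using (not-involutive; T-∧)
open import Data.Bool.ListAction using (any)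
open import Data.Unit.Base using (tt)
open import Data.Empty using (⊥; ⊥-elim)
open import Data.Product.Base using (_×_; _,_; proj₁; proj₂; uncurry)
open import Data.Product.Properties using (≡-dec)
open import Data.Sum.Base using (_⊎_; inj₁; inj₂)
open import Data.List.Base using (List; []; _∷_; _++_; _∷ʳ_; [_]; length; applyUpTo)
open import Data.List.Properties using (∷-injective; applyUpTo-∷ʳ; length-applyUpTo; map-upTo; length-++; ++-assoc)
open import Data.List.Relation.Unary.All as All using ()
open import Data.List.Relation.Unary.AllPairs using (_∷_)
open import Data.List.Relation.Unary.Any using (here; there)
open import Data.List.Relation.Unary.Any.Properties using (any⁺)
open import Data.List.Membership.Propositional using (_∈_; lose)
open import Data.List.Relation.Unary.Unique.Propositional using (Unique)
open import Function.Base using (_∘_)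
open import Function.Bundles using (Equivalence)
open import Relation.Binary.PropositionalEquality
  using (_≡_; _≢_; refl; sym; trans; cong; cong₂; subst; module ≡-Reasoning)
open import Relation.Nullary using (¬_; yes; no)

private variable
  A : Set

toℕ : Bool → ℕ
toℕ false = 0
toℕ true  = 1

toℕ-T : ∀ {b} → T b → toℕ b ≡ 1
toℕ-T {true} _ = refl

toℕ-¬T : ∀ {b} → ¬ T b → toℕ b ≡ 0
toℕ-¬T {true}  ¬b = ⊥-elim (¬b tt)
toℕ-¬T {false} _  = refl

toℕ≤1 : ∀ b → toℕ b ≤ 1
toℕ≤1 true  = ≤-refl
toℕ≤1 false = z≤n

toℕ-mono : ∀ {a b} → (T a → T b) → toℕ a ≤ toℕ b
toℕ-mono {false}          _ = z≤n
toℕ-mono {true} {true}    _ = ≤-refl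
toℕ-mono {true} {false} a⇒b = ⊥-elim (a⇒b tt)

toℕ-< : ∀ {a b} → ¬ T a → T b → toℕ a < toℕ b
toℕ-< {true}          ¬a _ = ⊥-elim (¬a tt)
toℕ-< {false} {true}  _  _ = s≤s z≤n

T-not⇒¬T : ∀ {b} → T (not b) → ¬ T b
T-not⇒¬T {true} ()

toℕ-∧-not+toℕ : ∀ {a} b → T a → toℕ (a ∧ not b) + toℕ b ≡ 1
toℕ-∧-not+toℕ {true} true  _ = refl
toℕ-∧-not+toℕ {true} false _ = refl

toℕ-not∧not+toℕ : ∀ a b → (T a → ¬ T b → ⊥) → toℕ (not a ∧ not b) + toℕ b ≡ 1
toℕ-not∧not+toℕ true  true  _ = refl
toℕ-not∧not+toℕ true  false h = ⊥-elim (h tt λ ())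
toℕ-not∧not+toℕ false true  _ = refl
toℕ-not∧not+toℕ false false _ = refl

<ᵇ-suc : ∀ x k → toℕ (x <ᵇ suc k) ≡ toℕ (x <ᵇ k) + toℕ (x ≡ᵇ k)
<ᵇ-suc zero    zero    = refl
<ᵇ-suc zero    (suc k) = refl
<ᵇ-suc (suc x) zero    = refl
<ᵇ-suc (suc x) (suc k) = <ᵇ-suc x k

≤ᵇ-suc : ∀ x k → toℕ (x ≤ᵇ suc k) ≡ toℕ (x ≤ᵇ k) + toℕ (x ≡ᵇ suc k)
≤ᵇ-suc zero    k = refl
≤ᵇ-suc (suc x) k = <ᵇ-suc x k

module _ (p : A → Bool) where

  countᵇ : List A → ℕ
  countᵇ []       = 0
  countᵇ (x ∷ xs) = toℕ (p x) + countᵇ xs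

  countᵇ-none : ∀ {xs} → (∀ {x} → x ∈ xs → ¬ T (p x)) → countᵇ xs ≡ 0
  countᵇ-none {[]}     _    = refl
  countᵇ-none {x ∷ xs} none =
    cong₂ _+_ (toℕ-¬T (none (here refl))) (countᵇ-none (none ∘ there))

  countᵇ-all : ∀ {xs} → (∀ {x} → x ∈ xs → T (p x)) → countᵇ xs ≡ length xs
  countᵇ-all {[]}     _   = refl
  countᵇ-all {x ∷ xs} all =
    cong₂ _+_ (toℕ-T (all (here refl))) (countᵇ-all (all ∘ there))

  countᵇ-unique : ∀ {xs} → Unique xs →
                  (∀ {x y} → x ∈ xs → y ∈ xs → T (p x) → T (p y) → x ≡ y) →
                  countᵇ xs ≡ toℕ (any p xs)
  countᵇ-unique {[]} _ _ = refl
  countᵇ-unique {x ∷ xs} (x∉xs ∷ unique) atMostOne with p x in px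
  ... | true  = cong suc (countᵇ-none (λ y∈xs py →
                  All.lookup x∉xs y∈xs (atMostOne (here refl) (there y∈xs) (subst T (sym px) tt) py)))
  ... | false = countᵇ-unique unique (λ x∈ y∈ → atMostOne (there x∈) (there y∈))

module _ {p q : A → Bool} where

  countᵇ-+ : ∀ {r} → (∀ x → toℕ (p x) ≡ toℕ (q x) + toℕ (r x)) →
             ∀ xs → countᵇ p xs ≡ countᵇ q xs + countᵇ r xs
  countᵇ-+ split []       = refl
  countᵇ-+ {r} split (x ∷ xs) =
    trans (cong₂ _+_ (split x) (countᵇ-+ split xs))
          (interchange (toℕ (q x)) (toℕ (r x)) (countᵇ q xs) (countᵇ r xs))

  countᵇ-mono : ∀ {xs} → (∀ {x} → x ∈ xs → T (p x) → T (q x)) → countᵇ p xs ≤ countᵇ q xs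
  countᵇ-mono {[]}     _   = z≤n
  countᵇ-mono {x ∷ xs} p⇒q = +-mono-≤ (toℕ-mono (p⇒q (here refl))) (countᵇ-mono (p⇒q ∘ there))

  countᵇ-mono-< : ∀ {xs y} → (∀ {x} → x ∈ xs → T (p x) → T (q x)) →
                  y ∈ xs → ¬ T (p y) → T (q y) → countᵇ p xs < countᵇ q xs
  countᵇ-mono-< p⇒q (here refl) ¬py qy = +-mono-<-≤ (toℕ-< ¬py qy) (countᵇ-mono (p⇒q ∘ there))
  countᵇ-mono-< p⇒q (there y∈)  ¬py qy =
    +-mono-≤-< (toℕ-mono (p⇒q (here refl))) (countᵇ-mono-< (p⇒q ∘ there) y∈ ¬py qy)

applyUpTo-++⁻ : ∀ (f : ℕ → A) N xs {ys} → applyUpTo f N ≡ xs ++ ys →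
                length xs ≤ N × xs ≡ applyUpTo f (length xs)
applyUpTo-++⁻ f N       []       _  = z≤n , refl
applyUpTo-++⁻ f zero    (x ∷ xs) ()
applyUpTo-++⁻ f (suc N) (x ∷ xs) eq with ∷-injective eq
... | refl , eq′ with applyUpTo-++⁻ (f ∘ suc) N xs eq′
...   | len≤ , xs≡ = s≤s len≤ , cong (f 0 ∷_) xs≡

applyUpTo-++-∷⁻ : ∀ (f : ℕ → A) N xs {y ys} → applyUpTo f N ≡ xs ++ y ∷ ys →
                  length xs < N × f (length xs) ≡ y
applyUpTo-++-∷⁻ f zero    []       ()
applyUpTo-++-∷⁻ f (suc N) []       eq = s≤s z≤n , proj₁ (∷-injective eq)
applyUpTo-++-∷⁻ f zero    (x ∷ xs) ()
applyUpTo-++-∷⁻ f (suc N) (x ∷ xs) eq with applyUpTo-++-∷⁻ (f ∘ suc) N xs (proj₂ (∷-injective eq))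
... | len< , fy = s≤s len< , fy

isU isD : Step → Bool
isU U = true
isU _ = false
isD D = true
isD _ = false

isU-if : ∀ a b → isU (if a then U else if b then D else H) ≡ a
isU-if true  _     = refl
isU-if false true  = refl
isU-if false false = refl

isD-if : ∀ a b → isD (if a then U else if b then D else H) ≡ not a ∧ b
isD-if true  _     = refl
isD-if false true  = refl
isD-if false false = refl

countU-∷ʳ : ∀ xs s → countU (xs ∷ʳ s) ≡ countU xs + toℕ (isU s)
countU-∷ʳ []      U = refl
countU-∷ʳ []      D = refl
countU-∷ʳ []      H = refl
countU-∷ʳ (U ∷ xs) s = cong suc (countU-∷ʳ xs s)
countU-∷ʳ (D ∷ xs) s = countU-∷ʳ xs s
countU-∷ʳ (H ∷ xs) s = countU-∷ʳ xs s

countD-∷ʳ : ∀ xs s → countD (xs ∷ʳ s) ≡ countD xs + toℕ (isD s)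
countD-∷ʳ []      U = refl
countD-∷ʳ []      D = refl
countD-∷ʳ []      H = refl
countD-∷ʳ (U ∷ xs) s = countD-∷ʳ xs s
countD-∷ʳ (D ∷ xs) s = cong suc (countD-∷ʳ xs s)
countD-∷ʳ (H ∷ xs) s = countD-∷ʳ xs s

-- The endpoints of (j , j+2) have the parity of j and its interior point the other one, so it is
-- forced above a sortable arc only when j+1 is odd and below one only when j+1 is even.
short-arc-interior : ∀ {j x} → Interior (j , suc (suc j)) x → x ≡ suc j
short-arc-interior (j<x , x<2+j) = ≤-antisym (≤-pred x<2+j) j<x

short-arc-endpoint : ∀ {j x} → IsEndpoint (j , suc (suc j)) x → isOdd (suc j) ≡ not (isOdd x)
short-arc-endpoint     (inj₁ refl) = refl
short-arc-endpoint {j} (inj₂ refl) = sym (not-involutive (isOdd (suc j)))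

short-arc-above : ∀ {j β x} → ForcedAbove (j , suc (suc j)) sortableAbove β sortableAbove x →
                  isOdd (suc j) ≡ true
short-arc-above (inj₁ (x∈ , _ , odd))  = trans (cong isOdd (sym (short-arc-interior x∈))) odd
short-arc-above (inj₂ (x∈ , _ , even)) = trans (short-arc-endpoint x∈) (cong not even)

short-arc-below : ∀ {j β x} → ForcedAbove β sortableAbove (j , suc (suc j)) sortableAbove x →
                  isOdd (suc j) ≡ false
short-arc-below (inj₁ (_ , x∈ , odd))  = trans (short-arc-endpoint x∈) (cong not odd)
short-arc-below (inj₂ (_ , x∈ , even)) = trans (cong isOdd (sym (short-arc-interior x∈))) even

short-arc-noncrossing : ∀ j β → ¬ Cross (j , suc (suc j)) sortableAbove β sortableAbove
                              × ¬ Cross β sortableAbove (j , suc (suc j)) sortableAbove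
short-arc-noncrossing j β =
  (λ { (_ , _ , above , below) → true≢false (trans (sym (short-arc-above above)) (short-arc-below below)) }) ,
  (λ { (_ , _ , below , above) → true≢false (trans (sym (short-arc-above above)) (short-arc-below below)) })
  where
  true≢false : true ≢ false
  true≢false ()

unit-arc-forcedAbove : ∀ {p β aₑ aβ x} → ForcedAbove (p , suc p) aₑ β aβ x →
                       IsEndpoint (p , suc p) x × Interior β x
unit-arc-forcedAbove (inj₁ ((p<x , x<1+p) , _)) = ⊥-elim (<-irrefl refl (≤-trans x<1+p p<x))
unit-arc-forcedAbove (inj₂ (x∈ , x∈β , _))      = x∈ , x∈β

unit-arc-noncrossing : ∀ {p β aₑ aβ} → (∀ {x} → IsEndpoint (p , suc p) x → ¬ Interior β x) →
                       ¬ Cross (p , suc p) aₑ β aβ × ¬ Cross β aβ (p , suc p) aₑ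
unit-arc-noncrossing {aₑ = aₑ} {aβ} unstraddled =
  (λ { (_ , _ , above , _) → uncurry unstraddled (unit-arc-forcedAbove {aₑ = aₑ} {aβ} above) }) ,
  (λ { (_ , _ , _ , above) → uncurry unstraddled (unit-arc-forcedAbove {aₑ = aₑ} {aβ} above) })

module MaximalDiagram (n : ℕ) (δ : List Endpoints) (mad : IsMAD n δ) where

  private
    R L : ℕ → Bool
    R = isRightEnd δ
    L = isLeftEnd δ

  arc : ∀ {a} → a ∈ δ → IsArc n a
  arc = proj₁ (proj₂ (proj₁ mad)) _

  leftEnd-of : ∀ {a} → a ∈ δ → T (L (proj₁ a))
  leftEnd-of {a} a∈ = any⁺ _ (lose a∈ (≡⇒≡ᵇ (proj₁ a) (proj₁ a) refl))

  rightEnd-of : ∀ {a} → a ∈ δ → T (R (proj₂ a))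
  rightEnd-of {a} a∈ = any⁺ _ (lose a∈ (≡⇒≡ᵇ (proj₂ a) (proj₂ a) refl))

  endpoint-injective : ∀ {a b} → a ∈ δ → b ∈ δ → (proj₁ a ≡ proj₁ b) ⊎ (proj₂ a ≡ proj₂ b) → a ≡ b
  endpoint-injective {a} {b} a∈ b∈ shared with ≡-dec _≟_ _≟_ a b
  ... | yes a≡b = a≡b
  ... | no  a≢b with proj₂ (proj₂ (proj₁ mad)) a b a∈ b∈ a≢b | shared
  ...   | ≢₁ , _ , _ | inj₁ eq = ⊥-elim (≢₁ eq)
  ...   | _ , ≢₂ , _ | inj₂ eq = ⊥-elim (≢₂ eq)

  no-free-arc : ∀ e → IsArc n e → ¬ T (L (proj₁ e)) → ¬ T (R (proj₂ e)) →
                (∀ {β} → β ∈ δ → ¬ Cross e sortableAbove β sortableAbove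
                               × ¬ Cross β sortableAbove e sortableAbove) → ⊥
  no-free-arc e e-arc ¬L ¬R noncrossing = e∉δ (proj₂ mad (e ∷ δ) extended (λ _ → there) e (here refl))
    where
    e∉δ : ¬ e ∈ δ
    e∉δ e∈ = ¬L (leftEnd-of e∈)

    arcs : ∀ a → a ∈ e ∷ δ → IsArc n a
    arcs _ (here refl) = e-arc
    arcs _ (there a∈)  = arc a∈

    pairs : ∀ a b → a ∈ e ∷ δ → b ∈ e ∷ δ → a ≢ b →
            (proj₁ a ≢ proj₁ b) × (proj₂ a ≢ proj₂ b) × ¬ Cross a sortableAbove b sortableAbove
    pairs _ _ (here refl) (here refl) a≢b = ⊥-elim (a≢b refl)
    pairs _ _ (here refl) (there b∈)  _   =
      (λ eq → ¬L (subst (T ∘ L) (sym eq) (leftEnd-of b∈))) ,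
      (λ eq → ¬R (subst (T ∘ R) (sym eq) (rightEnd-of b∈))) ,
      proj₁ (noncrossing b∈)
    pairs _ _ (there a∈)  (here refl) _   =
      (λ eq → ¬L (subst (T ∘ L) eq (leftEnd-of a∈))) ,
      (λ eq → ¬R (subst (T ∘ R) eq (rightEnd-of a∈))) ,
      proj₂ (noncrossing a∈)
    pairs a b (there a∈)  (there b∈)  a≢b = proj₂ (proj₂ (proj₁ mad)) a b a∈ b∈ a≢b

    extended : IsSortableNCD n (e ∷ δ)
    extended = (All.tabulate (λ b∈ e≡b → e∉δ (subst (_∈ δ) (sym e≡b) b∈)) ∷ proj₁ (proj₁ mad)) ,
               arcs , pairs

  step : ℕ → Step
  step k = letter n δ (suc k)

  prefix : ℕ → List Step
  prefix = applyUpTo step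

  Ψ≡prefix : Ψ n δ ≡ prefix (suc n)
  Ψ≡prefix = map-upTo step (suc n)

  isU-step : ∀ k → isU (step k) ≡ (suc k ≤ᵇ n) ∧ not (R (suc (suc k)))
  isU-step k = isU-if ((suc k ≤ᵇ n) ∧ not (R (suc (suc k)))) ((2 ≤ᵇ suc k) ∧ not (L k))

  isD-step : ∀ k → isD (step k) ≡ not ((suc k ≤ᵇ n) ∧ not (R (suc (suc k)))) ∧ ((2 ≤ᵇ suc k) ∧ not (L k))
  isD-step k = isD-if ((suc k ≤ᵇ n) ∧ not (R (suc (suc k)))) ((2 ≤ᵇ suc k) ∧ not (L k))

  U-or-rightEnd : ∀ {k} → k < n → toℕ (isU (step k)) + toℕ (R (suc (suc k))) ≡ 1
  U-or-rightEnd {k} k<n =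
    trans (cong (λ u → toℕ u + toℕ (R (suc (suc k)))) (isU-step _))
          (toℕ-∧-not+toℕ (R (suc (suc k))) (≤⇒≤ᵇ k<n))

  last-step-not-U : ¬ T (isU (step n))
  last-step-not-U t = <-irrefl refl (≤ᵇ⇒≤ (suc n) n (proj₁ (Equivalence.to T-∧ (subst T (isU-step _) t))))

  U-at⇒¬rightEnd : ∀ {k} → step k ≡ U → ¬ T (R (suc (suc k)))
  U-at⇒¬rightEnd eq =
    T-not⇒¬T (proj₂ (Equivalence.to T-∧ (subst T (isU-step _) (subst (T ∘ isU) (sym eq) tt))))

  short-arc-blocked : ∀ {k} → suc (suc k) ≤ n → ¬ T (R (suc (suc (suc k)))) → ¬ T (L (suc k)) → ⊥
  short-arc-blocked {k} 2+k≤n ¬R ¬L =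
    no-free-arc (suc k , suc (suc (suc k))) (s≤s z≤n , s≤s (n≤1+n (suc k)) , s≤s 2+k≤n) ¬L ¬R
                (λ {β} _ → short-arc-noncrossing (suc k) β)

  D-or-leftEnd : ∀ k → toℕ (isD (step (suc k))) + toℕ (L (suc k)) ≡ 1
  D-or-leftEnd k =
    trans (cong (λ d → toℕ d + toℕ (L (suc k))) (isD-step _)) (toℕ-not∧not+toℕ _ _ blocked)
    where
    blocked : T ((suc (suc k) ≤ᵇ n) ∧ not (R (suc (suc (suc k))))) → ¬ T (L (suc k)) → ⊥
    blocked t with Equivalence.to T-∧ t
    ... | 2+k≤ᵇn , ¬R = short-arc-blocked (≤ᵇ⇒≤ _ _ 2+k≤ᵇn) (T-not⇒¬T ¬R)

  first-step-not-D : ¬ T (isD (step 0))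
  first-step-not-D t = proj₂ (Equivalence.to T-∧ (subst T (isD-step _) t))

  D-at⇒¬leftEnd : ∀ {k} → step (suc k) ≡ D → ¬ T (L (suc k))
  D-at⇒¬leftEnd eq =
    T-not⇒¬T (proj₂ (Equivalence.to T-∧ (subst T (isD-step _) (subst (T ∘ isD) (sym eq) tt))))

  rightEndsUpTo leftEndsUpTo : ℕ → ℕ
  rightEndsUpTo x = countᵇ (λ a → proj₂ a ≤ᵇ x) δ
  leftEndsUpTo  x = countᵇ (λ a → proj₁ a ≤ᵇ x) δ

  rightEndsUpTo-suc : ∀ x → rightEndsUpTo (suc x) ≡ rightEndsUpTo x + toℕ (R (suc x))
  rightEndsUpTo-suc x =
    trans (countᵇ-+ (λ a → ≤ᵇ-suc (proj₂ a) x) δ)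
          (cong (rightEndsUpTo x +_) (countᵇ-unique _ (proj₁ (proj₁ mad)) λ a∈ b∈ a↦x b↦x →
             endpoint-injective a∈ b∈ (inj₂ (trans (≡ᵇ⇒≡ _ _ a↦x) (sym (≡ᵇ⇒≡ _ _ b↦x))))))

  leftEndsUpTo-suc : ∀ x → leftEndsUpTo (suc x) ≡ leftEndsUpTo x + toℕ (L (suc x))
  leftEndsUpTo-suc x =
    trans (countᵇ-+ (λ a → ≤ᵇ-suc (proj₁ a) x) δ)
          (cong (leftEndsUpTo x +_) (countᵇ-unique _ (proj₁ (proj₁ mad)) λ a∈ b∈ a↦x b↦x →
             endpoint-injective a∈ b∈ (inj₁ (trans (≡ᵇ⇒≡ _ _ a↦x) (sym (≡ᵇ⇒≡ _ _ b↦x))))))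

  rightEndsUpTo-1 : rightEndsUpTo 1 ≡ 0
  rightEndsUpTo-1 = countᵇ-none _ λ a∈ j≤ᵇ1 → let (1≤i , i<j , _) = arc a∈ in
    <-irrefl refl (≤-trans (≤-trans (s≤s 1≤i) i<j) (≤ᵇ⇒≤ _ 1 j≤ᵇ1))

  leftEndsUpTo-0 : leftEndsUpTo 0 ≡ 0
  leftEndsUpTo-0 = countᵇ-none _ λ a∈ i≤ᵇ0 → let (1≤i , _) = arc a∈ in
    <-irrefl refl (≤-trans 1≤i (≤ᵇ⇒≤ _ 0 i≤ᵇ0))

  rightEndsUpTo-all : rightEndsUpTo (suc n) ≡ length δ
  rightEndsUpTo-all = countᵇ-all _ λ a∈ → let (_ , _ , j≤1+n) = arc a∈ in ≤⇒≤ᵇ j≤1+n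

  leftEndsUpTo-all : leftEndsUpTo n ≡ length δ
  leftEndsUpTo-all = countᵇ-all _ λ a∈ → let (_ , i<j , j≤1+n) = arc a∈ in
    ≤⇒≤ᵇ (≤-pred (≤-trans i<j j≤1+n))

  rightEndsUpTo≤leftEndsUpTo : ∀ x → rightEndsUpTo (suc x) ≤ leftEndsUpTo x
  rightEndsUpTo≤leftEndsUpTo x = countᵇ-mono λ a∈ j≤ᵇ1+x → let (_ , i<j , _) = arc a∈ in
    ≤⇒≤ᵇ (≤-pred (≤-trans i<j (≤ᵇ⇒≤ _ _ j≤ᵇ1+x)))

  countU-prefix-suc : ∀ m → countU (prefix (suc m)) ≡ countU (prefix m) + toℕ (isU (step m))
  countU-prefix-suc m = trans (cong countU (sym (applyUpTo-∷ʳ step m))) (countU-∷ʳ (prefix m) (step m))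

  countD-prefix-suc : ∀ m → countD (prefix (suc m)) ≡ countD (prefix m) + toℕ (isD (step m))
  countD-prefix-suc m = trans (cong countD (sym (applyUpTo-∷ʳ step m))) (countD-∷ʳ (prefix m) (step m))

  countU-prefix : ∀ m → m ≤ n → countU (prefix m) + rightEndsUpTo (suc m) ≡ m
  countU-prefix zero    _   = rightEndsUpTo-1
  countU-prefix (suc m) m<n = begin
    countU (prefix (suc m)) + rightEndsUpTo (suc (suc m))
      ≡⟨ cong₂ _+_ (countU-prefix-suc m) (rightEndsUpTo-suc (suc m)) ⟩
    (countU (prefix m) + toℕ (isU (step m))) + (rightEndsUpTo (suc m) + toℕ (R (suc (suc m))))
      ≡⟨ interchange (countU (prefix m)) _ (rightEndsUpTo (suc m)) _ ⟩
    (countU (prefix m) + rightEndsUpTo (suc m)) + (toℕ (isU (step m)) + toℕ (R (suc (suc m))))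
      ≡⟨ cong₂ _+_ (countU-prefix m (<⇒≤ m<n)) (U-or-rightEnd m<n) ⟩
    m + 1
      ≡⟨ +-comm m 1 ⟩
    suc m ∎
    where open ≡-Reasoning

  countD-prefix : ∀ k → countD (prefix (suc k)) + leftEndsUpTo k ≡ k
  countD-prefix zero    = cong₂ _+_ (trans (countD-prefix-suc 0) (toℕ-¬T first-step-not-D)) leftEndsUpTo-0
  countD-prefix (suc k) = begin
    countD (prefix (suc (suc k))) + leftEndsUpTo (suc k)
      ≡⟨ cong₂ _+_ (countD-prefix-suc (suc k)) (leftEndsUpTo-suc k) ⟩
    (countD (prefix (suc k)) + toℕ (isD (step (suc k)))) + (leftEndsUpTo k + toℕ (L (suc k)))
      ≡⟨ interchange (countD (prefix (suc k))) _ (leftEndsUpTo k) _ ⟩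
    (countD (prefix (suc k)) + leftEndsUpTo k) + (toℕ (isD (step (suc k))) + toℕ (L (suc k)))
      ≡⟨ cong₂ _+_ (countD-prefix k) (D-or-leftEnd k) ⟩
    k + 1
      ≡⟨ +-comm k 1 ⟩
    suc k ∎
    where open ≡-Reasoning

  countU-total : countU (prefix (suc n)) + length δ ≡ n
  countU-total = begin
    countU (prefix (suc n)) + length δ
      ≡⟨ cong₂ _+_ (countU-prefix-suc n) (sym rightEndsUpTo-all) ⟩
    (countU (prefix n) + toℕ (isU (step n))) + rightEndsUpTo (suc n)
      ≡⟨ cong (λ u → (countU (prefix n) + u) + rightEndsUpTo (suc n)) (toℕ-¬T last-step-not-U) ⟩
    (countU (prefix n) + 0) + rightEndsUpTo (suc n)
      ≡⟨ cong (_+ rightEndsUpTo (suc n)) (+-identityʳ (countU (prefix n))) ⟩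
    countU (prefix n) + rightEndsUpTo (suc n)
      ≡⟨ countU-prefix n ≤-refl ⟩
    n ∎
    where open ≡-Reasoning

  countD-total : countD (prefix (suc n)) + length δ ≡ n
  countD-total = trans (cong (countD (prefix (suc n)) +_) (sym leftEndsUpTo-all)) (countD-prefix n)

  countU≡countD : countU (prefix (suc n)) ≡ countD (prefix (suc n))
  countU≡countD = +-cancelʳ-≡ (length δ) _ _ (trans countU-total (sym countD-total))

  height-prefix : ∀ {k} → k < n →
    countU (prefix (suc k)) + rightEndsUpTo (suc (suc k)) ≡ suc (countD (prefix (suc k)) + leftEndsUpTo k)
  height-prefix {k} k<n = trans (countU-prefix (suc k) k<n) (cong suc (sym (countD-prefix k)))

  rightEndsUpTo≤1+leftEndsUpTo : ∀ k → rightEndsUpTo (suc (suc k)) ≤ suc (leftEndsUpTo k)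
  rightEndsUpTo≤1+leftEndsUpTo k = begin
    rightEndsUpTo (suc (suc k))       ≤⟨ rightEndsUpTo≤leftEndsUpTo (suc k) ⟩
    leftEndsUpTo (suc k)              ≡⟨ leftEndsUpTo-suc k ⟩
    leftEndsUpTo k + toℕ (L (suc k))  ≤⟨ +-monoʳ-≤ (leftEndsUpTo k) (toℕ≤1 (L (suc k))) ⟩
    leftEndsUpTo k + 1                ≡⟨ +-comm (leftEndsUpTo k) 1 ⟩
    suc (leftEndsUpTo k)              ∎
    where open ≤-Reasoning

  prefix-nonnegative : ∀ m → m ≤ suc n → countD (prefix m) ≤ countU (prefix m)
  prefix-nonnegative zero    _         = z≤n
  prefix-nonnegative (suc k) (s≤s k≤n) with m≤n⇒m<n∨m≡n k≤n
  ... | inj₂ refl = ≤-reflexive (sym countU≡countD)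
  ... | inj₁ k<n  = +-cancelʳ-≤ (suc (leftEndsUpTo k)) _ _ (begin
    countD (prefix (suc k)) + suc (leftEndsUpTo k)          ≡⟨ +-suc _ _ ⟩
    suc (countD (prefix (suc k)) + leftEndsUpTo k)          ≡⟨ sym (height-prefix k<n) ⟩
    countU (prefix (suc k)) + rightEndsUpTo (suc (suc k))   ≤⟨ +-monoʳ-≤ _ (rightEndsUpTo≤1+leftEndsUpTo k) ⟩
    countU (prefix (suc k)) + suc (leftEndsUpTo k)          ∎)
    where open ≤-Reasoning

  prefix-isMotzkin : IsMotzkin (suc n) (prefix (suc n))
  prefix-isMotzkin = length-applyUpTo step (suc n) , countU≡countD , nonnegative
    where
    nonnegative : ∀ xs ys → prefix (suc n) ≡ xs ++ ys → countD xs ≤ countU xs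
    nonnegative xs ys w≡ with applyUpTo-++⁻ step (suc n) xs w≡
    ... | len≤ , xs≡ = subst (λ w → countD w ≤ countU w) (sym xs≡) (prefix-nonnegative (length xs) len≤)

  leftEnd≤1+p⇒≤p : ∀ {p β} → ¬ T (L (suc p)) → β ∈ δ → proj₁ β ≤ suc p → proj₁ β ≤ p
  leftEnd≤1+p⇒≤p ¬L β∈ i≤1+p = ≤-pred (≤∧≢⇒< i≤1+p λ i≡1+p → ¬L (subst (T ∘ L) i≡1+p (leftEnd-of β∈)))

  -- The arcs ending by p+2 are among those starting by p, so equal counts force the converse.
  balanced⇒rightEnd≤ : ∀ {p β} → rightEndsUpTo (suc (suc p)) ≡ leftEndsUpTo p → ¬ T (L (suc p)) →
                       β ∈ δ → proj₁ β ≤ p → proj₂ β ≤ suc (suc p)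
  balanced⇒rightEnd≤ {p} {β} balanced ¬L β∈ i≤p with proj₂ β ≤? suc (suc p)
  ... | yes j≤2+p = j≤2+p
  ... | no  j≰2+p = ⊥-elim (<-irrefl balanced
                      (countᵇ-mono-< ends-by⇒starts-by β∈ (j≰2+p ∘ ≤ᵇ⇒≤ _ _) (≤⇒≤ᵇ i≤p)))
    where
    ends-by⇒starts-by : ∀ {a} → a ∈ δ → T (proj₂ a ≤ᵇ suc (suc p)) → T (proj₁ a ≤ᵇ p)
    ends-by⇒starts-by a∈ j≤ᵇ2+p = let (_ , i<j , _) = arc a∈ in
      ≤⇒≤ᵇ (leftEnd≤1+p⇒≤p ¬L a∈ (≤-pred (≤-trans i<j (≤ᵇ⇒≤ _ _ j≤ᵇ2+p))))

  balanced⇒unit-arc-unstraddled : ∀ {p β x} → rightEndsUpTo (suc (suc p)) ≡ leftEndsUpTo p →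
    ¬ T (L (suc p)) → ¬ T (R (suc (suc p))) → β ∈ δ →
    IsEndpoint (suc p , suc (suc p)) x → ¬ Interior β x
  balanced⇒unit-arc-unstraddled balanced ¬L ¬R β∈ (inj₁ refl) (i<1+p , 1+p<j) =
    ¬R (subst (T ∘ R) (≤-antisym (balanced⇒rightEnd≤ balanced ¬L β∈ (≤-pred i<1+p)) 1+p<j) (rightEnd-of β∈))
  balanced⇒unit-arc-unstraddled balanced ¬L ¬R β∈ (inj₂ refl) (i<2+p , 2+p<j) =
    <-irrefl refl (≤-trans 2+p<j (balanced⇒rightEnd≤ balanced ¬L β∈ (leftEnd≤1+p⇒≤p ¬L β∈ (≤-pred i<2+p))))

  prefix-noPeakOfHeight1 : ¬ HasPeakOfHeight1 (prefix (suc n))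
  prefix-noPeakOfHeight1 (xs , ys , w≡ , height1) =
    no-free-arc (suc p , suc (suc p)) (s≤s z≤n , ≤-refl , proj₁ D-at-1+p) ¬L ¬R λ β∈ →
      unit-arc-noncrossing (balanced⇒unit-arc-unstraddled balanced ¬L ¬R β∈)
    where
    p = length xs

    U-at-p : p < suc n × step p ≡ U
    U-at-p = applyUpTo-++-∷⁻ step (suc n) xs w≡

    D-at-1+p : suc p < suc n × step (suc p) ≡ D
    D-at-1+p = subst (λ m → m < suc n × step m ≡ D) (trans (length-++ xs) (+-comm p 1))
                 (applyUpTo-++-∷⁻ step (suc n) (xs ∷ʳ U) (trans w≡ (sym (++-assoc xs [ U ] (D ∷ ys)))))

    ¬R : ¬ T (R (suc (suc p)))
    ¬R = U-at⇒¬rightEnd (proj₂ U-at-p)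

    ¬L : ¬ T (L (suc p))
    ¬L = D-at⇒¬leftEnd (proj₂ D-at-1+p)

    xs∷ʳU≡prefix : xs ∷ʳ U ≡ prefix (suc p)
    xs∷ʳU≡prefix = trans (cong₂ _∷ʳ_ (proj₂ (applyUpTo-++⁻ step (suc n) xs w≡)) (sym (proj₂ U-at-p)))
                         (applyUpTo-∷ʳ step p)

    countU≡1+countD : countU (prefix (suc p)) ≡ suc (countD (prefix (suc p)))
    countU≡1+countD = subst (λ w → countU w ≡ 1 + countD w) xs∷ʳU≡prefix height1

    balanced : rightEndsUpTo (suc (suc p)) ≡ leftEndsUpTo p
    balanced = +-cancelˡ-≡ (suc (countD (prefix (suc p)))) _ _ (begin
      suc (countD (prefix (suc p))) + rightEndsUpTo (suc (suc p))
        ≡⟨ cong (_+ rightEndsUpTo (suc (suc p))) (sym countU≡1+countD) ⟩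
      countU (prefix (suc p)) + rightEndsUpTo (suc (suc p))
        ≡⟨ height-prefix (≤-pred (proj₁ D-at-1+p)) ⟩
      suc (countD (prefix (suc p)) + leftEndsUpTo p) ∎)
      where open ≡-Reasoning


proposition8p9 : (n : ℕ) → 1 ≤ n → (δ : List Endpoints) → IsMAD n δ →
                 IsMotzkinBar (suc n) (Ψ n δ) × length δ + countU (Ψ n δ) ≡ n
proposition8p9 n _ δ mad =
  subst (λ w → IsMotzkinBar (suc n) w × length δ + countU w ≡ n) (sym Ψ≡prefix)
        ((prefix-isMotzkin , prefix-noPeakOfHeight1) , trans (+-comm (length δ) _) countU-total)
  where open MaximalDiagram n δ mad
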